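{- Let $R$ be a Riesz space with strong unit, $\mu$ a valuation on $\mathrm{Spec}(R)$, and $f\in R$ with $f\ge 0$. For every $N\in\mathbb{N}$, $N\ge1$, and every open interval $(r,s)$ with rationals $r<s$, there exist rationals $r',s'$ with $r<r'<s'<s$ such that $\Delta[r',s']<\frac1N$.
   Context: A Riesz space is a $\mathbb{Q}$-vector space with a compatible lattice order; $1$ is a strong unit if every $x$ satisfies $-n1\le x\le n1$ for some $n$; rationals $r$ are identified with $r1$. $\mathrm{Spec}(R)$ is the distributive lattice generated by symbols $D(a)$, $a\in R$, subject to $D(1)=1$, $D(a)\wedge D(-a)=0$, $D(a+b)\le D(a)\vee D(b)$, $D(a)=0$ if $a\le0$, $D(a\vee b)=D(a)\vee D(b)$. Lower reals are inhabited, downward closed, open subsets of $\mathbb{Q}$; upper reals dually; $1-$(lower real) is an upper real, and "$U<q$" for an upper real $U$ means $q\in U$. A valuation is a map $\mu$ from $\mathrm{Spec}(R)$ to nonnegative lower reals with $\mu(0)=0,\mu(1)=1$, modular ($\mu(x)+\mu(y)=\mu(x\vee y)+\mu(x\wedge y)$), monotone, and $\mu(D(a))\le\sup_{\varepsilon>0}\mu(D(a-\varepsilon))$. Here $\Delta[r',s']$ denotes the upper real $1-\mu(D(r'-f))-\mu(D(f-s'))$. -}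

module Defs where

open import Level using (Level; _⊔_) renaming (suc to lsuc)
open import Data.Nat using (ℕ)
open import Data.Integer using (+_)
open import Data.Rational as ℚ using (ℚ; 0ℚ; 1ℚ; _<_) renaming (_≤_ to _≤ℚ_; _+_ to _+ℚ_; _-_ to _-ℚ_)
open import Data.Rational.Properties using (+-*-commutativeRing)
open import Data.Product using (Σ; ∃; _×_; _,_)
open import Relation.Binary.Core using (Rel)
open import Relation.Binary.Lattice using (IsLattice)
open import Algebra.Core using (Op₂)
open import Algebra.Module.Bundles using (Module)

ℚ-ring = +-*-commutativeRing

record RieszSpace (c ℓ : Level) : Set (lsuc (c ⊔ ℓ)) where
  field
    vec : Module ℚ-ring c ℓ
  open Module vec using (Carrierᴹ; _≈ᴹ_; _+ᴹ_; _*ₗ_)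
  field
    _≤_       : Rel Carrierᴹ ℓ
    _∨_       : Op₂ Carrierᴹ
    _∧_       : Op₂ Carrierᴹ
    isLattice : IsLattice _≈ᴹ_ _≤_ _∨_ _∧_
    +-mono    : ∀ {x y} z → x ≤ y → (x +ᴹ z) ≤ (y +ᴹ z)
    *-mono    : ∀ {x y} (q : ℚ) → 0ℚ ≤ℚ q → x ≤ y → (q *ₗ x) ≤ (q *ₗ y)

module _ {c ℓ} (R : RieszSpace c ℓ) where
  open RieszSpace R
  open Module vec using (Carrierᴹ; _≈ᴹ_; _+ᴹ_; _*ₗ_; -ᴹ_; 0ᴹ)

  IsStrongUnit : Carrierᴹ → Set (c ⊔ ℓ)
  IsStrongUnit u = ∀ x → ∃ λ (n : ℕ) →
    (-ᴹ ((+ n ℚ./ 1) *ₗ u)) ≤ x × x ≤ ((+ n ℚ./ 1) *ₗ u)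

  module SpecOf (u : Carrierᴹ) where
    -- the rational r, identified with r·1
    ⟪_⟫ : ℚ → Carrierᴹ
    ⟪ r ⟫ = r *ₗ u

    _-ᴿ_ : Carrierᴹ → Carrierᴹ → Carrierᴹ
    a -ᴿ b = a +ᴹ (-ᴹ b)

    -- Spec(R): the distributive lattice generated by symbols D(a), a ∈ R,
    -- presented by terms modulo the congruence generated by the
    -- distributive (bounded) lattice axioms and the defining relations.
    data SpecTerm : Set c where
      D     : Carrierᴹ → SpecTerm
      top   : SpecTerm
      bot   : SpecTerm
      _⊔ˢ_  : SpecTerm → SpecTerm → SpecTerm
      _⊓ˢ_  : SpecTerm → SpecTerm → SpecTerm

    infix 4 _≈ˢ_
    data _≈ˢ_ : SpecTerm → SpecTerm → Set (c ⊔ ℓ) where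
      refl  : ∀ {x} → x ≈ˢ x
      sym   : ∀ {x y} → x ≈ˢ y → y ≈ˢ x
      trans : ∀ {x y z} → x ≈ˢ y → y ≈ˢ z → x ≈ˢ z
      ⊔-cong : ∀ {x x' y y'} → x ≈ˢ x' → y ≈ˢ y' → (x ⊔ˢ y) ≈ˢ (x' ⊔ˢ y')
      ⊓-cong : ∀ {x x' y y'} → x ≈ˢ x' → y ≈ˢ y' → (x ⊓ˢ y) ≈ˢ (x' ⊓ˢ y')
      D-cong : ∀ {a b} → a ≈ᴹ b → D a ≈ˢ D b
      ⊔-assoc : ∀ x y z → ((x ⊔ˢ y) ⊔ˢ z) ≈ˢ (x ⊔ˢ (y ⊔ˢ z))
      ⊓-assoc : ∀ x y z → ((x ⊓ˢ y) ⊓ˢ z) ≈ˢ (x ⊓ˢ (y ⊓ˢ z))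
      ⊔-comm  : ∀ x y → (x ⊔ˢ y) ≈ˢ (y ⊔ˢ x)
      ⊓-comm  : ∀ x y → (x ⊓ˢ y) ≈ˢ (y ⊓ˢ x)
      ⊔-absorbs-⊓ : ∀ x y → (x ⊔ˢ (x ⊓ˢ y)) ≈ˢ x
      ⊓-absorbs-⊔ : ∀ x y → (x ⊓ˢ (x ⊔ˢ y)) ≈ˢ x
      ⊓-distrib-⊔ : ∀ x y z → (x ⊓ˢ (y ⊔ˢ z)) ≈ˢ ((x ⊓ˢ y) ⊔ˢ (x ⊓ˢ z))
      ⊔-identity : ∀ x → (x ⊔ˢ bot) ≈ˢ x
      ⊓-identity : ∀ x → (x ⊓ˢ top) ≈ˢ x
      D-one  : D u ≈ˢ top
      D-neg  : ∀ a → (D a ⊓ˢ D (-ᴹ a)) ≈ˢ bot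
      D-add  : ∀ a b → (D (a +ᴹ b) ⊓ˢ (D a ⊔ˢ D b)) ≈ˢ D (a +ᴹ b)   -- D(a+b) ≤ D(a) ∨ D(b)
      D-nonpos : ∀ a → a ≤ 0ᴹ → D a ≈ˢ bot
      D-join : ∀ a b → D (a ∨ b) ≈ˢ (D a ⊔ˢ D b)

    _≤ˢ_ : SpecTerm → SpecTerm → Set (c ⊔ ℓ)
    x ≤ˢ y = (x ⊓ˢ y) ≈ˢ x

record LowerReal : Set₁ where
  field
    cut       : ℚ → Set
    inhabited : ∃ λ q → cut q
    downward  : ∀ {p q} → p ≤ℚ q → cut q → cut p
    open'     : ∀ {q} → cut q → ∃ λ q' → q < q' × cut q'
open LowerReal public

_≃ᴸ_ : (ℚ → Set) → (ℚ → Set) → Set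
L ≃ᴸ M = ∀ q → (L q → M q) × (M q → L q)

_⊆ᴸ_ : (ℚ → Set) → (ℚ → Set) → Set
L ⊆ᴸ M = ∀ q → L q → M q

cutOf : ℚ → ℚ → Set
cutOf r q = q < r

_+ᴸ_ : (ℚ → Set) → (ℚ → Set) → ℚ → Set
(L +ᴸ M) q = ∃ λ a → ∃ λ b → L a × M b × q < a +ℚ b

NonNeg : LowerReal → Set
NonNeg L = ∀ q → q < 0ℚ → cut L q

-- upper cut of (1 - L): q ∈ (1 - L) iff (1 - q) ∈ L
oneMinus : (ℚ → Set) → ℚ → Set
oneMinus L q = L (1ℚ -ℚ q)

module _ {c ℓ} (R : RieszSpace c ℓ) (u : Module.Carrierᴹ (RieszSpace.vec R)) where
  open RieszSpace R
  open Module vec using (Carrierᴹ; _*ₗ_; _+ᴹ_; -ᴹ_)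
  open SpecOf R u

  record Valuation : Set (lsuc (c ⊔ ℓ)) where
    field
      μ         : SpecTerm → LowerReal
      μ-cong    : ∀ {x y} → x ≈ˢ y → cut (μ x) ≃ᴸ cut (μ y)
      nonneg    : ∀ x → NonNeg (μ x)
      μ-bot     : cut (μ bot) ≃ᴸ cutOf 0ℚ
      μ-top     : cut (μ top) ≃ᴸ cutOf 1ℚ
      modular   : ∀ x y → (cut (μ x) +ᴸ cut (μ y)) ≃ᴸ (cut (μ (x ⊔ˢ y)) +ᴸ cut (μ (x ⊓ˢ y)))
      monotone  : ∀ {x y} → x ≤ˢ y → cut (μ x) ⊆ᴸ cut (μ y)
      continuous : ∀ a q → cut (μ (D a)) q →
                   ∃ λ ε → 0ℚ < ε × cut (μ (D (a -ᴿ ⟪ ε ⟫))) q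

  -- Δ[r',s'] = 1 - μ(D(r' - f)) - μ(D(f - s')), as an upper cut predicate
  Δ : Valuation → Carrierᴹ → ℚ → ℚ → ℚ → Set
  Δ V f r' s' = oneMinus (cut (μ (D (⟪ r' ⟫ -ᴿ f))) +ᴸ cut (μ (D (f -ᴿ ⟪ s' ⟫))))
    where open Valuation V

Elt : ∀ {c ℓ} → RieszSpace c ℓ → Set c
Elt R = Module.Carrierᴹ (RieszSpace.vec R)

zeroᴿ : ∀ {c ℓ} (R : RieszSpace c ℓ) → Elt R
zeroᴿ R = Module.0ᴹ (RieszSpace.vec R)

-- For p < p' the elements f − p and p' − f add up to (p' − p)·1, and D((p' − p)·1) = D(1) = 1
-- by the Archimedean property, so D(f − p) ∨ D(p' − f) = 1 and hence, by modularity,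
-- μ(D(f − p)) + μ(D(p' − f)) ≥ 1.  Put t = 1/N, ε = t/2, and climb from a point p of (r, s)
-- towards s, carrying a lower bound b for μ(D(p − f)): choose p < p₁ < p₂ < s and
-- a < μ(D(f − p₁)), b' < μ(D(p₂ − f)) with a + b' > 1 − ε.  If b + a > 1 − t, the pair (p, p₁)
-- is the one sought; otherwise b' > b + ε and the climb continues from p₂ with b'.  The bounds
-- stay below μ(1) = 1, so the climb ends after finitely many steps.
module Submission where

open import Defs
open import Data.Nat using (ℕ; NonZero)
open import Data.Integer using (+_)
open import Data.Rational using (ℚ; _<_; _/_)
open import Data.Product using (∃; _×_)

open import Level using (_⊔_)
open import Data.Nat as ℕ using (zero; suc)
import Data.Nat.Properties as ℕ
open import Data.Integer as ℤ using (+[1+_]; -[1+_])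
import Data.Integer.Properties as ℤ
open import Data.Integer.Solver using (module +-*-Solver)
open import Data.Rational as ℚ using (mkℚ; 0ℚ; 1ℚ; _≤_; _+_; _-_; toℚᵘ; ↥_)
import Data.Rational.Properties as ℚ
import Data.Rational.Solver as ℚSolver
open import Data.Rational.Unnormalised as ℚᵘ using (mkℚᵘ; *≡*; *<*) renaming (_≃_ to _≃ᵘ_; _+_ to _+ᵘ_)
import Data.Rational.Unnormalised.Properties as ℚᵘ
open import Data.Product using (_,_; proj₁; proj₂)
open import Data.Empty using (⊥-elim)
open import Relation.Nullary using (yes; no)
open import Relation.Binary.PropositionalEquality as ≡ using (_≡_; refl; cong; subst)
open import Relation.Binary.Bundles using (Poset; Preorder)
open import Relation.Binary.Lattice using (IsLattice)
import Relation.Binary.Reasoning.PartialOrder as PosetReasoning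
import Relation.Binary.Reasoning.Preorder as PreorderReasoning
open import Algebra.Module.Bundles using (Module)
import Algebra.Properties.AbelianGroup as AbelianGroupProperties
open import Algebra.Definitions.RawMonoid ℚ.+-0-rawMonoid using () renaming (_×_ to _×ℚ_)

toℚᵘ-×ℚ : ∀ k p → toℚᵘ (k ×ℚ p) ≃ᵘ mkℚᵘ (+ k ℤ.* ↥ p) (ℚ.denominator-1 p)
toℚᵘ-×ℚ zero    p              = *≡* refl
toℚᵘ-×ℚ (suc k) p@(mkℚ n d-1 _) = begin
  toℚᵘ (p + k ×ℚ p)                          ≈⟨ ℚ.toℚᵘ-homo-+ p (k ×ℚ p) ⟩
  toℚᵘ p +ᵘ toℚᵘ (k ×ℚ p)                    ≈⟨ ℚᵘ.+-congʳ (toℚᵘ p) (toℚᵘ-×ℚ k p) ⟩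
  mkℚᵘ n d-1 +ᵘ mkℚᵘ (+ k ℤ.* n) d-1         ≈⟨ *≡* cross ⟩
  mkℚᵘ (+ suc k ℤ.* n) d-1                   ∎
  where
  open ℚᵘ.≃-Reasoning
  open +-*-Solver
  d : ℕ
  d = suc d-1
  cross : (n ℤ.* + d ℤ.+ (+ k ℤ.* n) ℤ.* + d) ℤ.* + d ≡ (+ suc k ℤ.* n) ℤ.* + (d ℕ.* d)
  cross rewrite ℤ.pos-* d d =
    solve 3 (λ n k d → (n :* d :+ (k :* n) :* d) :* d := ((con (+ 1) :+ k) :* n) :* (d :* d))
      refl n (+ k) (+ d)

i≤+∣i∣ : ∀ i → i ℤ.≤ + ℤ.∣ i ∣
i≤+∣i∣ (+ n)    = ℤ.≤-refl
i≤+∣i∣ -[1+ n ] = ℤ.-≤+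

×ℚ-archimedean : ∀ {e} → 0ℚ < e → ∀ q → ∃ λ k → q < k ×ℚ e
×ℚ-archimedean {mkℚ (+ zero)   _ _} (ℚ.*<* (ℤ.+<+ ()))
×ℚ-archimedean {mkℚ -[1+ _ ]   _ _} (ℚ.*<* ())
×ℚ-archimedean {e@(mkℚ +[1+ ν ] δ _)} _ (mkℚ n d-1 _) =
  k , ℚ.toℚᵘ-cancel-< (ℚᵘ.<-respʳ-≃ (ℚᵘ.≃-sym (toℚᵘ-×ℚ k e)) (*<* cross))
  where
  open ℤ.≤-Reasoning
  m k : ℕ
  m = ℤ.∣ n ∣ ℕ.* suc δ
  k = suc m
  cross : n ℤ.* + suc δ ℤ.< (+ k ℤ.* +[1+ ν ]) ℤ.* + suc d-1
  cross = begin-strict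
    n ℤ.* + suc δ                  ≤⟨ ℤ.*-monoʳ-≤-nonNeg (+ suc δ) (i≤+∣i∣ n) ⟩
    + ℤ.∣ n ∣ ℤ.* + suc δ          ≡⟨ ≡.sym (ℤ.pos-* ℤ.∣ n ∣ (suc δ)) ⟩
    + m                            <⟨ ℤ.+<+ (ℕ.n<1+n m) ⟩
    + k                            ≤⟨ ℤ.+≤+ (ℕ.m≤m*n k (suc ν ℕ.* suc d-1)) ⟩
    + (k ℕ.* (suc ν ℕ.* suc d-1))  ≡⟨ cong +_ (≡.sym (ℕ.*-assoc k (suc ν) (suc d-1))) ⟩
    (+ k ℤ.* +[1+ ν ]) ℤ.* + suc d-1 ∎

climb-step-bound : ∀ {t x a b b'} →
  1ℚ - (ℚ.½ ℚ.* t + x) < b → b + a ≤ 1ℚ - t → 1ℚ - ℚ.½ ℚ.* t < a + b' → 1ℚ - x < b'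
climb-step-bound {t} {x} {a} {b} {b'} b-large b+a-small a+b'-large = begin-strict
  1ℚ - x                                    ≡⟨ solve 2 (λ t x → con 1ℚ :- x :=
                                                 ((con 1ℚ :- (con ℚ.½ :* t :+ x)) :+ (con 1ℚ :- con ℚ.½ :* t))
                                                   :- (con 1ℚ :- t)) refl t x ⟩
  ((1ℚ - (e + x)) + (1ℚ - e)) - c           <⟨ ℚ.+-monoˡ-< (ℚ.- c) (ℚ.+-mono-< b-large a+b'-large) ⟩
  (b + (a + b')) - c                        ≡⟨ solve 4 (λ a b b' c → (b :+ (a :+ b')) :- c := ((b :+ a) :- c) :+ b')
                                                 refl a b b' c ⟩
  ((b + a) - c) + b'                        ≤⟨ ℚ.+-monoˡ-≤ b' (ℚ.+-monoˡ-≤ (ℚ.- c) b+a-small) ⟩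
  (c - c) + b'                              ≡⟨ solve 2 (λ b' c → (c :- c) :+ b' := b') refl b' c ⟩
  b'                                        ∎
  where
  open ℚ.≤-Reasoning
  open ℚSolver.+-*-Solver
  e c : ℚ
  e = ℚ.½ ℚ.* t
  c = 1ℚ - t

module Climbing (X Y : ℚ → ℚ → Set)
  (Y-<1 : ∀ {p b} → Y p b → b < 1ℚ)
  (Y-neg : ∀ p {b} → b < 0ℚ → Y p b)
  (cover : ∀ {p p'} → p < p' → ∀ {q} → q < 1ℚ → (X p +ᴸ Y p') q)
  {t : ℚ} (t>0 : 0ℚ < t) {r s : ℚ} where

  GoodPair : Set
  GoodPair = ∃ λ r' → ∃ λ s' → r < r' × r' < s' × s' < s × (Y r' +ᴸ X s') (1ℚ - t)

  e : ℚ
  e = ℚ.½ ℚ.* t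

  e>0 : 0ℚ < e
  e>0 = ℚ.positive⁻¹ e {{ℚ.pos*pos⇒pos ℚ.½ t {{ℚ.positive t>0}}}}

  -- k bounds the number of remaining steps, since each failed step raises b by ε = e.
  climb : ∀ k {p b} → r < p → p < s → Y p b → 1ℚ - k ×ℚ e < b → GoodPair
  climb zero    _  _  Ypb 1<b = ⊥-elim (ℚ.<-asym 1<b (Y-<1 Ypb))
  climb (suc k) {p} {b} r<p p<s Ypb b-large with ℚ.<-dense p<s
  ... | p₁ , p<p₁ , p₁<s with ℚ.<-dense p₁<s
  ... | p₂ , p₁<p₂ , p₂<s with cover p₁<p₂ (ℚ.+-monoʳ-< 1ℚ (ℚ.neg-antimono-< e>0))
  ... | a , b' , Xp₁a , Yp₂b' , a+b'-large with (1ℚ - t) ℚ.<? (b + a)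
  ... | yes found = p , p₁ , r<p , p<p₁ , p₁<s , b , a , Ypb , Xp₁a , found
  ... | no ¬found = climb k (ℚ.<-trans r<p (ℚ.<-trans p<p₁ p₁<p₂)) p₂<s Yp₂b'
                      (climb-step-bound {t} {k ×ℚ e} b-large (ℚ.≮⇒≥ ¬found) a+b'-large)

  goodPair : r < s → GoodPair
  goodPair r<s with ℚ.<-dense r<s | ×ℚ-archimedean e>0 (1ℚ + 1ℚ)
  ... | m , r<m , m<s | k , 2<k×e =
    climb k r<m m<s (Y-neg m (ℚ.*<* ℤ.-<+)) (ℚ.+-monoʳ-< 1ℚ (ℚ.neg-antimono-< 2<k×e))

module RieszSpaceProperties {c ℓ} (R : RieszSpace c ℓ) where
  open RieszSpace R renaming (_≤_ to infix 4 _≤ᴿ_)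
  open Module vec
  open AbelianGroupProperties +ᴹ-abelianGroup using (\\-leftDividesʳ; inverseʳ-unique)

  ≤ᴿ-poset : Poset c ℓ ℓ
  ≤ᴿ-poset = record { isPartialOrder = IsLattice.isPartialOrder isLattice }

  open PosetReasoning ≤ᴿ-poset

  x≤y⇒x-y≤0 : ∀ {x y} → x ≤ᴿ y → x +ᴹ (-ᴹ y) ≤ᴿ 0ᴹ
  x≤y⇒x-y≤0 {x} {y} x≤y = begin
    x +ᴹ (-ᴹ y)   ≤⟨ +-mono (-ᴹ y) x≤y ⟩
    y +ᴹ (-ᴹ y)   ≈⟨ -ᴹ‿inverseʳ y ⟩
    0ᴹ            ∎

  *ₗ-monoˡ-≤ᴿ : ∀ {p q x} → p ℚ.≤ q → 0ᴹ ≤ᴿ x → p *ₗ x ≤ᴿ q *ₗ x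
  *ₗ-monoˡ-≤ᴿ {p} {q} {x} p≤q 0≤x = begin
    p *ₗ x                            ≈⟨ +ᴹ-identityˡ (p *ₗ x) ⟨
    0ᴹ +ᴹ p *ₗ x                      ≤⟨ +-mono (p *ₗ x) 0≤[q-p]x ⟩
    (q ℚ.- p) *ₗ x +ᴹ p *ₗ x          ≈⟨ *ₗ-distribʳ x (q ℚ.- p) p ⟨
    ((q ℚ.- p) ℚ.+ p) *ₗ x            ≡⟨ cong (_*ₗ x) (solve 2 (λ p q → (q :- p) :+ p := q) refl p q) ⟩
    q *ₗ x                            ∎
    where
    open ℚSolver.+-*-Solver
    0≤q-p : 0ℚ ℚ.≤ q ℚ.- p
    0≤q-p = subst (ℚ._≤ q ℚ.- p) (ℚ.+-inverseʳ p) (ℚ.+-monoˡ-≤ (ℚ.- p) p≤q)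
    0≤[q-p]x : 0ᴹ ≤ᴿ (q ℚ.- p) *ₗ x
    0≤[q-p]x = begin
      0ᴹ                     ≈⟨ *ₗ-zeroʳ (q ℚ.- p) ⟨
      (q ℚ.- p) *ₗ 0ᴹ        ≤⟨ *-mono (q ℚ.- p) 0≤q-p 0≤x ⟩
      (q ℚ.- p) *ₗ x         ∎

  0≤*ₗ⇒0≤ : ∀ {p x} → 0ℚ < p → 0ᴹ ≤ᴿ p *ₗ x → 0ᴹ ≤ᴿ x
  0≤*ₗ⇒0≤ {p} {x} 0<p 0≤px = begin
    0ᴹ                   ≈⟨ *ₗ-zeroʳ p⁻¹ ⟨
    p⁻¹ *ₗ 0ᴹ            ≤⟨ *-mono p⁻¹ 0≤p⁻¹ 0≤px ⟩
    p⁻¹ *ₗ (p *ₗ x)      ≈⟨ *ₗ-assoc p⁻¹ p x ⟨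
    (p⁻¹ ℚ.* p) *ₗ x     ≡⟨ cong (_*ₗ x) (ℚ.*-inverseˡ p) ⟩
    1ℚ *ₗ x              ≈⟨ *ₗ-identityˡ x ⟩
    x                    ∎
    where
    instance
      p-pos : ℚ.Positive p
      p-pos = ℚ.positive 0<p
      p-nonZero : ℚ.NonZero p
      p-nonZero = ℚ.pos⇒nonZero p
    p⁻¹ : ℚ
    p⁻¹ = ℚ.1/ p
    0≤p⁻¹ : 0ℚ ℚ.≤ p⁻¹
    0≤p⁻¹ = ℚ.nonNegative⁻¹ p⁻¹ {{ℚ.pos⇒nonNeg p⁻¹ {{ℚ.1/pos⇒pos p}}}}

  strongUnit⇒0≤ : ∀ {u} → IsStrongUnit R u → 0ᴹ ≤ᴿ u
  strongUnit⇒0≤ {u} isStrong with isStrong u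
  ... | n , -nu≤u , _ = 0≤*ₗ⇒0≤ 0<1+n (begin
    0ᴹ                          ≈⟨ -ᴹ‿inverseˡ (n' *ₗ u) ⟨
    -ᴹ (n' *ₗ u) +ᴹ n' *ₗ u     ≤⟨ +-mono (n' *ₗ u) -nu≤u ⟩
    u +ᴹ n' *ₗ u                ≈⟨ +ᴹ-congʳ (*ₗ-identityˡ u) ⟨
    1ℚ *ₗ u +ᴹ n' *ₗ u          ≈⟨ *ₗ-distribʳ u 1ℚ n' ⟨
    (1ℚ ℚ.+ n') *ₗ u            ∎)
    where
    n' : ℚ
    n' = + n ℚ./ 1
    0<1+n : 0ℚ < 1ℚ ℚ.+ n'
    0<1+n = ℚ.+-mono-<-≤ {0ℚ} {1ℚ} {0ℚ} {n'} (ℚ.positive⁻¹ 1ℚ) (ℚ.nonNegative⁻¹ n' {{ℚ.normalize-nonNeg n 1}})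

  +ᴹ-cancel-middle : ∀ x y z → (x +ᴹ (-ᴹ y)) +ᴹ (z +ᴹ (-ᴹ x)) ≈ᴹ z +ᴹ (-ᴹ y)
  +ᴹ-cancel-middle x y z = begin-equality
    (x +ᴹ (-ᴹ y)) +ᴹ (z +ᴹ (-ᴹ x))    ≈⟨ +ᴹ-comm _ _ ⟩
    (z +ᴹ (-ᴹ x)) +ᴹ (x +ᴹ (-ᴹ y))    ≈⟨ +ᴹ-assoc z (-ᴹ x) _ ⟩
    z +ᴹ ((-ᴹ x) +ᴹ (x +ᴹ (-ᴹ y)))    ≈⟨ +ᴹ-congˡ (\\-leftDividesʳ x (-ᴹ y)) ⟩
    z +ᴹ (-ᴹ y)                       ∎

  *ₗ-distribʳ-‿- : ∀ x p q → (p ℚ.- q) *ₗ x ≈ᴹ p *ₗ x +ᴹ (-ᴹ (q *ₗ x))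
  *ₗ-distribʳ-‿- x p q = begin-equality
    (p ℚ.- q) *ₗ x                ≈⟨ *ₗ-distribʳ x p (ℚ.- q) ⟩
    p *ₗ x +ᴹ (ℚ.- q) *ₗ x        ≈⟨ +ᴹ-congˡ (inverseʳ-unique (q *ₗ x) ((ℚ.- q) *ₗ x) q-q) ⟩
    p *ₗ x +ᴹ (-ᴹ (q *ₗ x))       ∎
    where
    q-q : q *ₗ x +ᴹ (ℚ.- q) *ₗ x ≈ᴹ 0ᴹ
    q-q = begin-equality
      q *ₗ x +ᴹ (ℚ.- q) *ₗ x      ≈⟨ *ₗ-distribʳ x q (ℚ.- q) ⟨
      (q ℚ.- q) *ₗ x              ≡⟨ cong (_*ₗ x) (ℚ.+-inverseʳ q) ⟩
      0ℚ *ₗ x                     ≈⟨ *ₗ-zeroˡ x ⟩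
      0ᴹ                          ∎

module SpecProperties {c ℓ} (R : RieszSpace c ℓ) (u : Elt R) where
  open RieszSpace R renaming (_≤_ to infix 4 _≤ᴿ_)
  open Module vec
  open SpecOf R u
  open RieszSpaceProperties R

  ⊓ˢ-idem : ∀ x → (x ⊓ˢ x) ≈ˢ x
  ⊓ˢ-idem x = trans (⊓-cong refl (sym (⊔-absorbs-⊓ x x))) (⊓-absorbs-⊔ x (x ⊓ˢ x))

  ≤ˢ-trans : ∀ {x y z} → x ≤ˢ y → y ≤ˢ z → x ≤ˢ z
  ≤ˢ-trans {x} {y} {z} x≤y y≤z =
    trans (⊓-cong (sym x≤y) refl) (trans (⊓-assoc x y z) (trans (⊓-cong refl y≤z) x≤y))

  ≤ˢ-preorder : Preorder c (c ⊔ ℓ) (c ⊔ ℓ)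
  ≤ˢ-preorder = record
    { Carrier    = SpecTerm
    ; _≈_        = _≈ˢ_
    ; _≲_        = _≤ˢ_
    ; isPreorder = record
      { isEquivalence = record { refl = refl ; sym = sym ; trans = trans }
      ; reflexive     = λ x≈y → trans (⊓-cong refl (sym x≈y)) (⊓ˢ-idem _)
      ; trans         = ≤ˢ-trans
      }
    }

  bot-≤ˢ : ∀ x → bot ≤ˢ x
  bot-≤ˢ x = trans (⊓-cong refl (trans (sym (⊔-identity x)) (⊔-comm x bot))) (⊓-absorbs-⊔ bot x)

  ⊔ˢ-absorbs-≤ˢ : ∀ {x y} → y ≤ˢ x → (x ⊔ˢ y) ≈ˢ x
  ⊔ˢ-absorbs-≤ˢ {x} {y} y≤x = trans (⊔-cong refl (trans (sym y≤x) (⊓-comm y x))) (⊔-absorbs-⊓ x y)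

  open PreorderReasoning ≤ˢ-preorder

  D-mono : ∀ {a b} → a ≤ᴿ b → D a ≤ˢ D b
  D-mono {a} {b} a≤b = begin
    D a                          ≈⟨ D-cong (≈ᴹ-sym b+[a-b]≈a) ⟩
    D (b +ᴹ (a -ᴿ b))            ≲⟨ D-add b (a -ᴿ b) ⟩
    D b ⊔ˢ D (a -ᴿ b)            ≈⟨ ⊔-cong refl (D-nonpos (a -ᴿ b) (x≤y⇒x-y≤0 a≤b)) ⟩
    D b ⊔ˢ bot                   ≈⟨ ⊔-identity (D b) ⟩
    D b                          ∎
    where
    open AbelianGroupProperties +ᴹ-abelianGroup using (\\-leftDividesˡ)
    b+[a-b]≈a : b +ᴹ (a -ᴿ b) ≈ᴹ a
    b+[a-b]≈a = ≈ᴹ-trans (+ᴹ-congˡ (+ᴹ-comm a (-ᴹ b))) (\\-leftDividesˡ b a)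

  D-×ℚ : ∀ k p x → D ((k ×ℚ p) *ₗ x) ≤ˢ D (p *ₗ x)
  D-×ℚ zero    p x = begin
    D (0ℚ *ₗ x)   ≈⟨ D-cong (*ₗ-zeroˡ x) ⟩
    D 0ᴹ          ≈⟨ D-nonpos 0ᴹ (IsLattice.refl isLattice) ⟩
    bot           ≲⟨ bot-≤ˢ (D (p *ₗ x)) ⟩
    D (p *ₗ x)    ∎
  D-×ℚ (suc k) p x = begin
    D ((p ℚ.+ k ×ℚ p) *ₗ x)              ≈⟨ D-cong (*ₗ-distribʳ x p (k ×ℚ p)) ⟩
    D (p *ₗ x +ᴹ (k ×ℚ p) *ₗ x)          ≲⟨ D-add (p *ₗ x) ((k ×ℚ p) *ₗ x) ⟩
    D (p *ₗ x) ⊔ˢ D ((k ×ℚ p) *ₗ x)      ≈⟨ ⊔ˢ-absorbs-≤ˢ (D-×ℚ k p x) ⟩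
    D (p *ₗ x)                           ∎

  module _ (0≤u : 0ᴹ ≤ᴿ u) where

    top≤D[p·u] : ∀ {p} → 0ℚ < p → top ≤ˢ D (p *ₗ u)
    top≤D[p·u] {p} 0<p with ×ℚ-archimedean 0<p 1ℚ
    ... | k , 1<k×p = begin
      top                  ≈⟨ sym D-one ⟩
      D u                  ≈⟨ D-cong (≈ᴹ-sym (*ₗ-identityˡ u)) ⟩
      D (1ℚ *ₗ u)          ≲⟨ D-mono (*ₗ-monoˡ-≤ᴿ (ℚ.<⇒≤ 1<k×p) 0≤u) ⟩
      D ((k ×ℚ p) *ₗ u)    ≲⟨ D-×ℚ k p u ⟩
      D (p *ₗ u)           ∎

    top≤D[f-p]⊔D[p'-f] : ∀ f {p p'} → p < p' → top ≤ˢ (D (f -ᴿ ⟪ p ⟫) ⊔ˢ D (⟪ p' ⟫ -ᴿ f))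
    top≤D[f-p]⊔D[p'-f] f {p} {p'} p<p' = begin
      top                                  ≲⟨ top≤D[p·u] 0<p'-p ⟩
      D ((p' ℚ.- p) *ₗ u)                  ≈⟨ D-cong (*ₗ-distribʳ-‿- u p' p) ⟩
      D (⟪ p' ⟫ -ᴿ ⟪ p ⟫)                  ≈⟨ D-cong (≈ᴹ-sym (+ᴹ-cancel-middle f ⟪ p ⟫ ⟪ p' ⟫)) ⟩
      D ((f -ᴿ ⟪ p ⟫) +ᴹ (⟪ p' ⟫ -ᴿ f))    ≲⟨ D-add (f -ᴿ ⟪ p ⟫) (⟪ p' ⟫ -ᴿ f) ⟩
      D (f -ᴿ ⟪ p ⟫) ⊔ˢ D (⟪ p' ⟫ -ᴿ f)    ∎
      where
      0<p'-p : 0ℚ < p' ℚ.- p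
      0<p'-p = subst (_< p' ℚ.- p) (ℚ.+-inverseʳ p) (ℚ.+-monoˡ-< (ℚ.- p) p<p')

module ValuationProperties {c ℓ} (R : RieszSpace c ℓ) (u : Elt R) (V : Valuation R u) where
  open SpecOf R u
  open Valuation V

  μ-subadditive : ∀ x y → cut (μ (x ⊔ˢ y)) ⊆ᴸ (cut (μ x) +ᴸ cut (μ y))
  μ-subadditive x y q μ[x⊔y]q with open' (μ (x ⊔ˢ y)) μ[x⊔y]q
  ... | q' , q<q' , μ[x⊔y]q' with ℚ.<-dense q<q'
  ... | m , q<m , m<q' = proj₂ (modular x y q) (q' , m ℚ.- q' , μ[x⊔y]q' , μ[x⊓y][m-q'] , q<q'+[m-q'])
    where
    open ℚSolver.+-*-Solver
    μ[x⊓y][m-q'] : cut (μ (x ⊓ˢ y)) (m ℚ.- q')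
    μ[x⊓y][m-q'] = nonneg (x ⊓ˢ y) (m ℚ.- q')
      (subst (m ℚ.- q' <_) (ℚ.+-inverseʳ q') (ℚ.+-monoˡ-< (ℚ.- q') m<q'))
    q<q'+[m-q'] : q < q' ℚ.+ (m ℚ.- q')
    q<q'+[m-q'] = subst (q <_) (solve 2 (λ m q' → m := q' :+ (m :- q')) refl m q') q<m

  μ<1 : ∀ x {q} → cut (μ x) q → q < 1ℚ
  μ<1 x {q} μxq = proj₁ (μ-top q) (monotone (⊓-identity x) q μxq)

  top≤ˢ⇒μ≥1 : ∀ {x} → top ≤ˢ x → ∀ {q} → q < 1ℚ → cut (μ x) q
  top≤ˢ⇒μ≥1 top≤x {q} q<1 = monotone top≤x q (proj₂ (μ-top q) q<1)

theorem4p14 : ∀ {c ℓ} (R : RieszSpace c ℓ) (u : Elt R) → IsStrongUnit R u →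
    (V : Valuation R u) (f : Elt R) → RieszSpace._≤_ R (zeroᴿ R) f →
    (N : ℕ) .{{_ : NonZero N}} → (r s : ℚ) → r < s →
    ∃ λ r' → ∃ λ s' → r < r' × r' < s' × s' < s × Δ R u V f r' s' ((+ 1) / N)
theorem4p14 R u isStrongUnit V f _ N r s r<s = goodPair r<s
  where
  open SpecOf R u
  open Valuation V
  open ValuationProperties R u V
  open SpecProperties R u using (top≤D[f-p]⊔D[p'-f])
  t : ℚ
  t = (+ 1) / N
  t>0 : 0ℚ < t
  t>0 = ℚ.positive⁻¹ t {{ℚ.normalize-pos 1 N}}
  X Y : ℚ → ℚ → Set
  X p = cut (μ (D (f -ᴿ ⟪ p ⟫)))
  Y p = cut (μ (D (⟪ p ⟫ -ᴿ f)))
  cover : ∀ {p p'} → p < p' → ∀ {q} → q < 1ℚ → (X p +ᴸ Y p') q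
  cover p<p' q<1 = μ-subadditive _ _ _
    (top≤ˢ⇒μ≥1 (top≤D[f-p]⊔D[p'-f] (RieszSpaceProperties.strongUnit⇒0≤ R isStrongUnit) f p<p') q<1)
  open Climbing X Y (μ<1 _) (λ p {b} → nonneg (D (⟪ p ⟫ -ᴿ f)) b) cover t>0
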